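{- Let $p,q$ be positive integers with $t=p/q<1$. A snark $G$ admits a $t$-flow-pair if and only if there exist a perfect matching $M$ of $G$ and a $(p+q+1)$-flow $\varphi_{p+q+1}$ on $G$ such that $|\varphi_{p+q+1}(e)|\ge q$ for every edge $e\in M$.
   Context: A snark is a $2$-connected simple cubic graph that is not $3$-edge-colourable. For a positive integer $k$, a $k$-flow on a graph $G=(V,E)$ is an orientation of the edges together with an integer-valued map $\varphi\colon E\to\mathbb{Z}$ with $|\varphi(e)|\le k-1$ for all edges (zero values allowed) satisfying flow conservation at every vertex (sum on incoming edges equals sum on outgoing edges). For a rational $0<t\le1$, a $t$-flow-pair of $G$ is a pair consisting of a $2$-flow $\varphi_2$ and a $(p'+q'+1)$-flow $\varphi_{p'+q'+1}$ with the same orientation, for some positive integers $p',q'$ with $t=p'/q'$, such that for every edge $e$, if $\varphi_2(e)=0$ then $|\varphi_{p'+q'+1}(e)|\ge q'$. -}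

module Defs where

open import Data.Nat using (ℕ; zero; suc; _+_; _*_; _<_; _≤_)
open import Data.Integer as ℤ using (ℤ; ∣_∣)
open import Data.Fin using (Fin; zero; suc; _≟_)
open import Data.Bool using (Bool; true; false; if_then_else_)
open import Data.Product using (Σ; ∃; _×_; _,_)
open import Data.Sum using (_⊎_)
open import Relation.Nullary using (¬_)
open import Relation.Nullary.Decidable using (⌊_⌋)
open import Relation.Binary.PropositionalEquality using (_≡_; _≢_)

record Graph : Set where
  field
    n   : ℕ
    m   : ℕ
    src : Fin m → Fin n
    tgt : Fin m → Fin n
open Graph public

sumℕ : ∀ {k} → (Fin k → ℕ) → ℕ
sumℕ {zero}  f = 0
sumℕ {suc k} f = f zero + sumℕ (λ i → f (suc i))

sumℤ : ∀ {k} → (Fin k → ℤ) → ℤ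
sumℤ {zero}  f = ℤ.0ℤ
sumℤ {suc k} f = f zero ℤ.+ sumℤ (λ i → f (suc i))

module _ (G : Graph) where

  Incident : Fin (m G) → Fin (n G) → Set
  Incident e v = (src G e ≡ v) ⊎ (tgt G e ≡ v)

  -- number of edge-ends at v (loops counted twice)
  degree : Fin (n G) → ℕ
  degree v = sumℕ (λ e → (if ⌊ src G e ≟ v ⌋ then 1 else 0)
                        + (if ⌊ tgt G e ≟ v ⌋ then 1 else 0))

  Simple : Set
  Simple = (∀ e → src G e ≢ tgt G e)
         × (∀ e f → e ≢ f →
              ¬ ((src G e ≡ src G f × tgt G e ≡ tgt G f)
                 ⊎ (src G e ≡ tgt G f × tgt G e ≡ src G f)))

  Cubic : Set
  Cubic = ∀ v → degree v ≡ 3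

  Adj : Fin (n G) → Fin (n G) → Set
  Adj u v = ∃ λ e → (src G e ≡ u × tgt G e ≡ v) ⊎ (src G e ≡ v × tgt G e ≡ u)

  data ReachAvoid (x : Fin (n G)) : Fin (n G) → Fin (n G) → Set where
    here : ∀ {u} → u ≢ x → ReachAvoid x u u
    step : ∀ {u w v} → u ≢ x → Adj u w → ReachAvoid x w v → ReachAvoid x u v

  TwoConnected : Set
  TwoConnected = (3 ≤ n G)
               × (∀ x u v → u ≢ x → v ≢ x → ReachAvoid x u v)

  ThreeEdgeColourable : Set
  ThreeEdgeColourable =
    Σ (Fin (m G) → Fin 3) λ c →
      ∀ e f v → e ≢ f → Incident e v → Incident f v → c e ≢ c f

  Snark : Set
  Snark = TwoConnected × Simple × Cubic × ¬ ThreeEdgeColourable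

  -- An orientation: o e = true orients e from src to tgt, false from tgt to src.
  Orientation : Set
  Orientation = Fin (m G) → Bool

  tail head : Orientation → Fin (m G) → Fin (n G)
  tail o e = if o e then src G e else tgt G e
  head o e = if o e then tgt G e else src G e

  IsFlow : ℕ → Orientation → (Fin (m G) → ℤ) → Set
  IsFlow k o φ =
      (∀ e → ∣ φ e ∣ < k)
    × (∀ v → sumℤ (λ e → if ⌊ head o e ≟ v ⌋ then φ e else ℤ.0ℤ)
           ≡ sumℤ (λ e → if ⌊ tail o e ≟ v ⌋ then φ e else ℤ.0ℤ))

  PerfectMatching : (Fin (m G) → Bool) → Set
  PerfectMatching M =
    ∀ v → sumℕ (λ e → if M e then
                         (if ⌊ src G e ≟ v ⌋ then 1 else 0)
                         + (if ⌊ tgt G e ≟ v ⌋ then 1 else 0)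
                       else 0) ≡ 1

  HasFlowPair : ℕ → ℕ → Set
  HasFlowPair p q =
    Σ ℕ λ p' → Σ ℕ λ q' → (0 < p') × (0 < q') × (p' * q ≡ p * q') ×
    Σ Orientation λ o → Σ (Fin (m G) → ℤ) λ φ₂ → Σ (Fin (m G) → ℤ) λ φ →
      IsFlow 2 o φ₂ × IsFlow (p' + q' + 1) o φ ×
      (∀ e → φ₂ e ≡ ℤ.0ℤ → q' ≤ ∣ φ e ∣)

-- For a t-flow-pair (φ₂, φ) with t = p′/q′, the edges where φ₂ vanishes form a perfect matching:
-- at every vertex the edges where a 2-flow is nonzero are even in number, and if all three edges at
-- a vertex had φ₂ = 0, their φ-values, of absolute value between q′ and p′ + q′, could not sum to
-- zero because p′ < q′. Rescaling φ gives the (p+q+1)-flow: q φ is a ℤ_{q′}-flow, hence congruent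
-- mod q′ to a q′-flow r by Tutte's lifting lemma, and ψ = (q φ − r)/q′ works. Conversely, in a cubic
-- graph the complement of a perfect matching meets every vertex twice, so its indicator is a
-- ℤ₂-flow and lifts to a 2-flow vanishing exactly on the matching.
--
-- The lifting lemma is proved by augmentation: start from the residues of h mod k and push k along
-- residual paths from surplus to deficit vertices, which exist by a cut argument, until the total
-- absolute excess vanishes.

module Submission where

open import Defs
open import Function using (_∘_)
open import Data.Nat using (ℕ; NonZero)
open import Data.Bool using (Bool; true; false; if_then_else_; _∨_)
open import Data.Fin using (Fin; zero; suc; _≟_)
open import Data.Product using (Σ; ∃; _×_; _,_; proj₁; proj₂)
open import Data.Sum using (_⊎_; inj₁; inj₂)
open import Data.Empty using (⊥; ⊥-elim)
open import Relation.Nullary using (¬_; yes; no; Dec)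
open import Relation.Nullary.Decidable using (⌊_⌋; _×-dec_; _⊎-dec_)
open import Relation.Binary.PropositionalEquality

if-swap : ∀ {a} {A : Set a} (b c : Bool) (x z : A) →
          (if b then (if c then x else z) else z) ≡ (if c then (if b then x else z) else z)
if-swap true  c     x z = refl
if-swap false true  x z = refl
if-swap false false x z = refl

≟-refl : ∀ {k} (a : Fin k) → ⌊ a ≟ a ⌋ ≡ true
≟-refl a with a ≟ a
... | yes _   = refl
... | no  a≢a = ⊥-elim (a≢a refl)

≢⇒≟-false : ∀ {k} {a b : Fin k} → a ≢ b → ⌊ a ≟ b ⌋ ≡ false
≢⇒≟-false {a = a} {b} a≢b with a ≟ b
... | yes a≡b = ⊥-elim (a≢b a≡b)
... | no  _   = refl

module SumℕProperties where
  open import Data.Nat hiding (_≟_)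
  open import Data.Nat.Properties hiding (_≟_)
  open import Algebra.Properties.CommutativeSemigroup +-commutativeSemigroup using (interchange)

  sumℕ-cong : ∀ {k} {f g : Fin k → ℕ} → (∀ i → f i ≡ g i) → sumℕ f ≡ sumℕ g
  sumℕ-cong {zero}  f≗g = refl
  sumℕ-cong {suc k} f≗g = cong₂ _+_ (f≗g zero) (sumℕ-cong (f≗g ∘ suc))

  sumℕ-distrib-+ : ∀ {k} (f g : Fin k → ℕ) → sumℕ (λ i → f i + g i) ≡ sumℕ f + sumℕ g
  sumℕ-distrib-+ {zero}  f g = refl
  sumℕ-distrib-+ {suc k} f g =
    trans (cong ((f zero + g zero) +_) (sumℕ-distrib-+ (f ∘ suc) (g ∘ suc)))
          (interchange (f zero) (g zero) _ _)

  *-distribˡ-sumℕ : ∀ {k} c (f : Fin k → ℕ) → c * sumℕ f ≡ sumℕ (λ i → c * f i)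
  *-distribˡ-sumℕ {zero}  c f = *-zeroʳ c
  *-distribˡ-sumℕ {suc k} c f =
    trans (*-distribˡ-+ c (f zero) _) (cong (c * f zero +_) (*-distribˡ-sumℕ c (f ∘ suc)))

  sumℕ-mono-≤ : ∀ {k} {f g : Fin k → ℕ} → (∀ i → f i ≤ g i) → sumℕ f ≤ sumℕ g
  sumℕ-mono-≤ {zero}  f≤g = z≤n
  sumℕ-mono-≤ {suc k} f≤g = +-mono-≤ (f≤g zero) (sumℕ-mono-≤ (f≤g ∘ suc))

  sumℕ-mono-< : ∀ {k} {f g : Fin k → ℕ} (a : Fin k) →
                (∀ i → f i ≤ g i) → f a < g a → sumℕ f < sumℕ g
  sumℕ-mono-< {suc k} zero    f≤g fa<ga = +-mono-<-≤ fa<ga (sumℕ-mono-≤ (f≤g ∘ suc))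
  sumℕ-mono-< {suc k} (suc a) f≤g fa<ga = +-mono-≤-< (f≤g zero) (sumℕ-mono-< a (f≤g ∘ suc) fa<ga)

  sumℕ≡0⇒≡0 : ∀ {k} (f : Fin k → ℕ) → sumℕ f ≡ 0 → ∀ i → f i ≡ 0
  sumℕ≡0⇒≡0 {suc k} f Σf≡0 zero    = m+n≡0⇒m≡0 (f zero) Σf≡0
  sumℕ≡0⇒≡0 {suc k} f Σf≡0 (suc i) = sumℕ≡0⇒≡0 (f ∘ suc) (m+n≡0⇒n≡0 (f zero) Σf≡0) i

  sumℕ-zero : ∀ k → sumℕ {k} (λ _ → 0) ≡ 0
  sumℕ-zero zero    = refl
  sumℕ-zero (suc k) = sumℕ-zero k

  sumℕ-select : ∀ {k} (a : Fin k) x → sumℕ (λ j → if ⌊ a ≟ j ⌋ then x else 0) ≡ x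
  sumℕ-select {suc k} zero    x = trans (cong (x +_) (sumℕ-zero k)) (+-identityʳ x)
  sumℕ-select {suc k} (suc a) x = trans (sumℕ-cong shift) (sumℕ-select a x)
    where
    shift : ∀ j → (if ⌊ suc a ≟ suc j ⌋ then x else 0) ≡ (if ⌊ a ≟ j ⌋ then x else 0)
    shift j with a ≟ j
    ... | yes _ = refl
    ... | no  _ = refl

  sumℕ-+-select : ∀ {k} (f : Fin k → ℕ) (a : Fin k) x →
                  sumℕ (λ j → f j + (if ⌊ a ≟ j ⌋ then x else 0)) ≡ sumℕ f + x
  sumℕ-+-select f a x = trans (sumℕ-distrib-+ f _) (cong (sumℕ f +_) (sumℕ-select a x))

module SumℤProperties where
  open import Data.Nat as ℕ using (zero; suc)
  open import Data.Integer using (ℤ; +_; 0ℤ; -_; _+_; _-_; _*_; _≤_; _<_)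
  open import Data.Integer.Properties hiding (_≟_)
  open import Data.Integer.Divisibility.Signed using (_∣_; divides; ∣m∣n⇒∣m+n)
  open import Algebra.Properties.CommutativeSemigroup +-commutativeSemigroup using (interchange)

  sumℤ-cong : ∀ {k} {f g : Fin k → ℤ} → (∀ i → f i ≡ g i) → sumℤ f ≡ sumℤ g
  sumℤ-cong {zero}  f≗g = refl
  sumℤ-cong {suc k} f≗g = cong₂ _+_ (f≗g zero) (sumℤ-cong (f≗g ∘ suc))

  sumℤ-distrib-+ : ∀ {k} (f g : Fin k → ℤ) → sumℤ (λ i → f i + g i) ≡ sumℤ f + sumℤ g
  sumℤ-distrib-+ {zero}  f g = refl
  sumℤ-distrib-+ {suc k} f g =
    trans (cong (_+_ (f zero + g zero)) (sumℤ-distrib-+ (f ∘ suc) (g ∘ suc)))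
          (interchange (f zero) (g zero) _ _)

  *-distribˡ-sumℤ : ∀ {k} c (f : Fin k → ℤ) → c * sumℤ f ≡ sumℤ (λ i → c * f i)
  *-distribˡ-sumℤ {zero}  c f = *-zeroʳ c
  *-distribˡ-sumℤ {suc k} c f =
    trans (*-distribˡ-+ c (f zero) _) (cong (_+_ (c * f zero)) (*-distribˡ-sumℤ c (f ∘ suc)))

  sumℤ-neg : ∀ {k} (f : Fin k → ℤ) → sumℤ (λ i → - f i) ≡ - sumℤ f
  sumℤ-neg {zero}  f = refl
  sumℤ-neg {suc k} f =
    trans (cong (_+_ (- f zero)) (sumℤ-neg (f ∘ suc))) (sym (neg-distrib-+ (f zero) _))

  sumℤ-distrib-- : ∀ {k} (f g : Fin k → ℤ) → sumℤ (λ i → f i - g i) ≡ sumℤ f - sumℤ g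
  sumℤ-distrib-- f g = trans (sumℤ-distrib-+ f (λ i → - g i)) (cong (_+_ (sumℤ f)) (sumℤ-neg g))

  sumℤ-zero : ∀ k → sumℤ {k} (λ _ → 0ℤ) ≡ 0ℤ
  sumℤ-zero zero    = refl
  sumℤ-zero (suc k) = trans (+-identityˡ _) (sumℤ-zero k)

  sumℤ-comm : ∀ {k l} (f : Fin k → Fin l → ℤ) →
              sumℤ (λ i → sumℤ (λ j → f i j)) ≡ sumℤ (λ j → sumℤ (λ i → f i j))
  sumℤ-comm {zero}  {l} f = sym (sumℤ-zero l)
  sumℤ-comm {suc k} {l} f =
    trans (cong (_+_ (sumℤ (f zero))) (sumℤ-comm (f ∘ suc)))
          (sym (sumℤ-distrib-+ (f zero) (λ j → sumℤ (λ i → f (suc i) j))))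

  sumℤ-select : ∀ {k} (a : Fin k) (f : Fin k → ℤ) →
                sumℤ (λ j → if ⌊ a ≟ j ⌋ then f j else 0ℤ) ≡ f a
  sumℤ-select {suc k} zero    f = trans (cong (_+_ (f zero)) (sumℤ-zero k)) (+-identityʳ (f zero))
  sumℤ-select {suc k} (suc a) f =
    trans (+-identityˡ _) (trans (sumℤ-cong shift) (sumℤ-select a (f ∘ suc)))
    where
    shift : ∀ j → (if ⌊ suc a ≟ suc j ⌋ then f (suc j) else 0ℤ) ≡ (if ⌊ a ≟ j ⌋ then f (suc j) else 0ℤ)
    shift j with a ≟ j
    ... | yes _ = refl
    ... | no  _ = refl

  if-sumℤ : ∀ {k} b (f : Fin k → ℤ) → (if b then sumℤ f else 0ℤ) ≡ sumℤ (λ i → if b then f i else 0ℤ)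
  if-sumℤ true  f = refl
  if-sumℤ {k} false f = sym (sumℤ-zero k)

  sumℤ-mono-≤ : ∀ {k} {f g : Fin k → ℤ} → (∀ i → f i ≤ g i) → sumℤ f ≤ sumℤ g
  sumℤ-mono-≤ {zero}  f≤g = ≤-refl
  sumℤ-mono-≤ {suc k} f≤g = +-mono-≤ (f≤g zero) (sumℤ-mono-≤ (f≤g ∘ suc))

  sumℤ-mono-< : ∀ {k} {f g : Fin k → ℤ} (a : Fin k) →
                (∀ i → f i ≤ g i) → f a < g a → sumℤ f < sumℤ g
  sumℤ-mono-< {suc k} zero    f≤g fa<ga = +-mono-<-≤ fa<ga (sumℤ-mono-≤ (f≤g ∘ suc))
  sumℤ-mono-< {suc k} (suc a) f≤g fa<ga = +-mono-≤-< (f≤g zero) (sumℤ-mono-< a (f≤g ∘ suc) fa<ga)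

  sumℤ-pos : ∀ {k} (f : Fin k → ℕ) → sumℤ (λ i → + f i) ≡ + sumℕ f
  sumℤ-pos {zero}  f = refl
  sumℤ-pos {suc k} f = trans (cong (_+_ (+ f zero)) (sumℤ-pos (f ∘ suc))) (sym (pos-+ (f zero) _))

  ∣0 : ∀ d → d ∣ 0ℤ
  ∣0 d = divides 0ℤ (sym (*-zeroˡ d))

  ∣-sumℤ : ∀ {d k} {f : Fin k → ℤ} → (∀ i → d ∣ f i) → d ∣ sumℤ f
  ∣-sumℤ {d} {zero}  d∣f = ∣0 d
  ∣-sumℤ {d} {suc k} d∣f = ∣m∣n⇒∣m+n (d∣f zero) (∣-sumℤ (d∣f ∘ suc))

module Arithmetic where
  open import Data.Nat as ℕ using (zero; suc; z<s)
  import Data.Nat.Properties as ℕ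
  import Data.Nat.Divisibility as ℕ
  open import Data.Integer using (+_; -[1+_]; 0ℤ; -_; _+_; _-_; ∣_∣; _≤_; _<_; +≤+; +<+)
  open import Data.Integer.Properties
    using (pos-+; ⊖-≥; ∣-i∣≡∣i∣; neg-mono-≤; neg-mono-<; +-monoʳ-≤; +-inverseʳ; i≤j⇒0≤j-i)
  open import Data.Integer.Divisibility.Signed using (_∣_; ∣⇒∣ᵤ; ∣m⇒∣-m)
  open import Data.Integer.Tactic.RingSolver using (solve-∀)
  open import Data.Nat.Tactic.RingSolver renaming (solve-∀ to ℕsolve-∀)

  <+1⇒≤ : ∀ {m n} → m ℕ.< n ℕ.+ 1 → m ℕ.≤ n
  <+1⇒≤ {m} {n} m<n+1 = ℕ.m<1+n⇒m≤n (subst (m ℕ.<_) (ℕ.+-comm n 1) m<n+1)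

  ratio-< : ∀ {p q p′ q′} → 0 ℕ.< q′ → p′ ℕ.* q ≡ p ℕ.* q′ → p ℕ.< q → p′ ℕ.< q′
  ratio-< {p} {q} {p′} {suc c} _ p′q≡pq′ p<q = ℕ.*-cancelʳ-< q p′ (suc c) (begin-strict
    p′ ℕ.* q        ≡⟨ p′q≡pq′ ⟩
    p ℕ.* suc c     <⟨ ℕ.*-monoˡ-< (suc c) p<q ⟩
    q ℕ.* suc c     ≡⟨ ℕ.*-comm q (suc c) ⟩
    suc c ℕ.* q     ∎)
    where open ℕ.≤-Reasoning

  quotient-upper : ∀ {p q p′ c a f r} → p′ ℕ.* q ≡ p ℕ.* suc c → f ℕ.≤ p′ ℕ.+ suc c → r ℕ.≤ c →
                   suc c ℕ.* a ℕ.≤ q ℕ.* f ℕ.+ r → a ℕ.< p ℕ.+ q ℕ.+ 1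
  quotient-upper {p} {q} {p′} {c} {a} {f} {r} p′q≡pk f≤p′+k r≤c ka≤qf+r =
    ℕ.*-cancelˡ-< (suc c) a (p ℕ.+ q ℕ.+ 1) (begin-strict
      suc c ℕ.* a                             ≤⟨ ka≤qf+r ⟩
      q ℕ.* f ℕ.+ r                           ≤⟨ ℕ.+-mono-≤ (ℕ.*-monoʳ-≤ q f≤p′+k) r≤c ⟩
      q ℕ.* (p′ ℕ.+ suc c) ℕ.+ c              ≡⟨ expand q p′ c ⟩
      p′ ℕ.* q ℕ.+ q ℕ.* suc c ℕ.+ c          ≡⟨ cong (λ t → t ℕ.+ q ℕ.* suc c ℕ.+ c) p′q≡pk ⟩
      p ℕ.* suc c ℕ.+ q ℕ.* suc c ℕ.+ c       <⟨ ℕ.+-monoʳ-< (p ℕ.* suc c ℕ.+ q ℕ.* suc c) (ℕ.n<1+n c) ⟩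
      p ℕ.* suc c ℕ.+ q ℕ.* suc c ℕ.+ suc c   ≡⟨ collect p q c ⟩
      suc c ℕ.* (p ℕ.+ q ℕ.+ 1)               ∎)
    where
    open ℕ.≤-Reasoning
    expand : ∀ q p′ c → q ℕ.* (p′ ℕ.+ suc c) ℕ.+ c ≡ p′ ℕ.* q ℕ.+ q ℕ.* suc c ℕ.+ c
    expand = ℕsolve-∀
    collect : ∀ p q c → p ℕ.* suc c ℕ.+ q ℕ.* suc c ℕ.+ suc c ≡ suc c ℕ.* (p ℕ.+ q ℕ.+ 1)
    collect = ℕsolve-∀

  quotient-lower : ∀ {q c a f r} → suc c ℕ.≤ f → q ℕ.* f ℕ.≤ r ℕ.+ suc c ℕ.* a → r ℕ.≤ c → q ℕ.≤ a
  quotient-lower {q} {c} {a} {f} {r} k≤f qf≤r+ka r≤c = ℕ.≤-pred (ℕ.*-cancelˡ-< (suc c) q (suc a) (begin-strict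
    suc c ℕ.* q             ≡⟨ ℕ.*-comm (suc c) q ⟩
    q ℕ.* suc c             ≤⟨ ℕ.*-monoʳ-≤ q k≤f ⟩
    q ℕ.* f                 ≤⟨ qf≤r+ka ⟩
    r ℕ.+ suc c ℕ.* a       ≤⟨ ℕ.+-monoˡ-≤ (suc c ℕ.* a) r≤c ⟩
    c ℕ.+ suc c ℕ.* a       <⟨ ℕ.+-monoˡ-< (suc c ℕ.* a) (ℕ.n<1+n c) ⟩
    suc c ℕ.+ suc c ℕ.* a   ≡⟨ ℕ.*-suc (suc c) a ⟨
    suc c ℕ.* suc a         ∎))
    where open ℕ.≤-Reasoning

  private
    neg-[i-k] : ∀ i k → - (i - k) ≡ - i + k
    neg-[i-k] = solve-∀

    ∣i-k∣≡∣-i+k∣ : ∀ i k → ∣ i - k ∣ ≡ ∣ - i + k ∣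
    ∣i-k∣≡∣-i+k∣ i k = trans (sym (∣-i∣≡∣i∣ (i - k))) (cong ∣_∣ (neg-[i-k] i k))

  ∣i+k∣<k : ∀ {i k} → i < 0ℤ → ∣ i ∣ ℕ.< k → ∣ i + + k ∣ ℕ.< k
  ∣i+k∣<k {+ _}      (+<+ ())
  ∣i+k∣<k { -[1+ m ]} {k} _ 1+m<k =
    subst (ℕ._< k) (cong ∣_∣ (sym (⊖-≥ 1+m≤k))) (ℕ.∸-monoʳ-< z<s 1+m≤k)
    where
    1+m≤k : suc m ℕ.≤ k
    1+m≤k = ℕ.<⇒≤ 1+m<k

  ∣i-k∣<k : ∀ {i k} → 0ℤ < i → ∣ i ∣ ℕ.< k → ∣ i - + k ∣ ℕ.< k
  ∣i-k∣<k {i} {k} pos ∣i∣<k =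
    subst (ℕ._< k) (sym (∣i-k∣≡∣-i+k∣ i (+ k)))
          (∣i+k∣<k (neg-mono-< pos) (subst (ℕ._< k) (sym (∣-i∣≡∣i∣ i)) ∣i∣<k))

  ∣i+k∣≡∣i∣+k : ∀ {i} k → 0ℤ ≤ i → ∣ i + + k ∣ ≡ ∣ i ∣ ℕ.+ k
  ∣i+k∣≡∣i∣+k {+ m} k _ = cong ∣_∣ (sym (pos-+ m k))

  ∣i-k∣≡∣i∣+k : ∀ {i} k → i ≤ 0ℤ → ∣ i - + k ∣ ≡ ∣ i ∣ ℕ.+ k
  ∣i-k∣≡∣i∣+k {i} k i≤0 = begin
    ∣ i - + k ∣      ≡⟨ ∣i-k∣≡∣-i+k∣ i (+ k) ⟩
    ∣ - i + + k ∣    ≡⟨ ∣i+k∣≡∣i∣+k k (neg-mono-≤ i≤0) ⟩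
    ∣ - i ∣ ℕ.+ k    ≡⟨ cong (ℕ._+ k) (∣-i∣≡∣i∣ i) ⟩
    ∣ i ∣ ℕ.+ k      ∎
    where open ≡-Reasoning

  ∣i-k∣+k≡∣i∣ : ∀ {i k} → + k ≤ i → ∣ i - + k ∣ ℕ.+ k ≡ ∣ i ∣
  ∣i-k∣+k≡∣i∣ {i} {k} k≤i = begin
    ∣ i - + k ∣ ℕ.+ k     ≡⟨ ∣i+k∣≡∣i∣+k k (i≤j⇒0≤j-i k≤i) ⟨
    ∣ i - + k + + k ∣     ≡⟨ cong ∣_∣ (minus-plus i (+ k)) ⟩
    ∣ i ∣                 ∎
    where
    open ≡-Reasoning
    minus-plus : ∀ i k → i - k + k ≡ i
    minus-plus = solve-∀

  ∣i+k∣+k≡∣i∣ : ∀ {i k} → i + + k ≤ 0ℤ → ∣ i + + k ∣ ℕ.+ k ≡ ∣ i ∣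
  ∣i+k∣+k≡∣i∣ {i} {k} i+k≤0 = begin
    ∣ i + + k ∣ ℕ.+ k     ≡⟨ ∣i-k∣≡∣i∣+k k i+k≤0 ⟨
    ∣ i + + k - + k ∣     ≡⟨ cong ∣_∣ (plus-minus i (+ k)) ⟩
    ∣ i ∣                 ∎
    where
    open ≡-Reasoning
    plus-minus : ∀ i k → i + k - k ≡ i
    plus-minus = solve-∀

  ∣∧pos⇒≥ : ∀ {i k} → + k ∣ i → 0ℤ < i → + k ≤ i
  ∣∧pos⇒≥ {+ zero}  _   (+<+ ())
  ∣∧pos⇒≥ {+ suc m} k∣i _ = +≤+ (ℕ.∣⇒≤ (∣⇒∣ᵤ k∣i))

  ∣∧neg⇒≤- : ∀ {i k} → + k ∣ i → i < 0ℤ → i + + k ≤ 0ℤ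
  ∣∧neg⇒≤- {i} k∣i neg =
    subst (i + _ ≤_) (+-inverseʳ i) (+-monoʳ-≤ i (∣∧pos⇒≥ (∣m⇒∣-m k∣i) (neg-mono-< neg)))

module BalancedTriples where
  open import Data.Nat as ℕ using (zero; suc; _≤_; _<_; z≤n)
  import Data.Nat.Properties as ℕ
  open import Data.Nat.Tactic.RingSolver using (solve-∀)
  open import Data.Integer as ℤ using (ℤ; +_; -[1+_]; 0ℤ; ∣_∣)
  import Data.Integer.Properties as ℤ
  open SumℕProperties
  open SumℤProperties using (sumℤ-cong; sumℤ-distrib--; sumℤ-pos)

  positivePart negativePart isPositive isNegative : ℤ → ℕ
  positivePart (+ n)    = n
  positivePart -[1+ n ] = 0
  negativePart (+ n)    = 0
  negativePart -[1+ n ] = suc n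
  isPositive (+ zero)   = 0
  isPositive (+ suc n)  = 1
  isPositive -[1+ n ]   = 0
  isNegative (+ n)      = 0
  isNegative -[1+ n ]   = 1

  support-nonzero : ∀ {i} → i ≢ 0ℤ → isPositive i ℕ.+ isNegative i ≡ 1
  support-nonzero {+ zero}   i≢0 = ⊥-elim (i≢0 refl)
  support-nonzero {+ suc n}  _   = refl
  support-nonzero { -[1+ n ]} _  = refl

  positive-negative : ∀ i → i ≡ + positivePart i ℤ.- + negativePart i
  positive-negative (+ n)    = sym (ℤ.+-identityʳ (+ n))
  positive-negative -[1+ n ] = refl

  Moderate : ℕ → ℕ → ℤ → Set
  Moderate q K i = i ≡ 0ℤ ⊎ (q ≤ ∣ i ∣ × ∣ i ∣ ≤ K)

  positivePart-bounds : ∀ {q K} i → Moderate q K i →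
                        q ℕ.* isPositive i ≤ positivePart i × positivePart i ≤ K ℕ.* isPositive i
  positivePart-bounds {q} (+ zero) _ = ℕ.≤-reflexive (ℕ.*-zeroʳ q) , z≤n
  positivePart-bounds (+ suc n) (inj₁ ())
  positivePart-bounds {q} {K} (+ suc n) (inj₂ (q≤i , i≤K)) =
    subst (_≤ suc n) (sym (ℕ.*-identityʳ q)) q≤i , subst (suc n ≤_) (sym (ℕ.*-identityʳ K)) i≤K
  positivePart-bounds {q} -[1+ n ] _ = ℕ.≤-reflexive (ℕ.*-zeroʳ q) , z≤n

  negativePart-bounds : ∀ {q K} i → Moderate q K i →
                        q ℕ.* isNegative i ≤ negativePart i × negativePart i ≤ K ℕ.* isNegative i
  negativePart-bounds {q} (+ n) _ = ℕ.≤-reflexive (ℕ.*-zeroʳ q) , z≤n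
  negativePart-bounds {q} {K} -[1+ n ] (inj₁ ())
  negativePart-bounds {q} {K} -[1+ n ] (inj₂ (q≤i , i≤K)) =
    subst (_≤ suc n) (sym (ℕ.*-identityʳ q)) q≤i , subst (suc n ≤_) (sym (ℕ.*-identityʳ K)) i≤K

  private
    two-against-one : ∀ {p q S} → p < q → q ℕ.* 2 ≤ S → S ≤ (p ℕ.+ q) ℕ.* 1 → ⊥
    two-against-one {p} {q} {S} p<q lower upper = ℕ.<⇒≱ p<q (ℕ.+-cancelʳ-≤ q q p (begin
      q ℕ.+ q           ≡⟨ double q ⟩
      q ℕ.* 2           ≤⟨ lower ⟩
      S                 ≤⟨ upper ⟩
      (p ℕ.+ q) ℕ.* 1   ≡⟨ ℕ.*-identityʳ _ ⟩
      p ℕ.+ q           ∎))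
      where
      open ℕ.≤-Reasoning
      double : ∀ q → q ℕ.+ q ≡ q ℕ.* 2
      double = solve-∀

    three-against-none : ∀ {p q S} → p < q → q ℕ.* 3 ≤ S → S ≤ (p ℕ.+ q) ℕ.* 0 → ⊥
    three-against-none {p} {suc q} {S} _ lower upper
      with ℕ.≤-trans lower (ℕ.≤-trans upper (ℕ.≤-reflexive (ℕ.*-zeroʳ (p ℕ.+ suc q))))
    ... | ()

  -- kP positive and kN negative terms, each of absolute value in [q, p + q], whose positive
  -- and negative parts both total S.
  unbalanced-split : ∀ {p q kP kN S} → p < q → kP ℕ.+ kN ≡ 3 →
    q ℕ.* kP ≤ S → S ≤ (p ℕ.+ q) ℕ.* kP → q ℕ.* kN ≤ S → S ≤ (p ℕ.+ q) ℕ.* kN → ⊥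
  unbalanced-split {kP = 0} p<q refl _ upperP lowerN _ = three-against-none p<q lowerN upperP
  unbalanced-split {kP = 1} p<q refl _ upperP lowerN _ = two-against-one p<q lowerN upperP
  unbalanced-split {kP = 2} p<q refl lowerP _ _ upperN = two-against-one p<q lowerP upperN
  unbalanced-split {kP = 3} p<q refl lowerP _ _ upperN = three-against-none p<q lowerP upperN
  unbalanced-split {kP = suc (suc (suc (suc _)))} _ ()

  no-moderate-zero-sum-triple : ∀ {p q k} → p < q → (s : Fin k → ℤ) →
    (∀ i → Moderate q (p ℕ.+ q) (s i)) → sumℤ s ≡ 0ℤ →
    sumℕ (λ i → isPositive (s i) ℕ.+ isNegative (s i)) ≢ 3
  no-moderate-zero-sum-triple {p} {q} {k} p<q s moderate sum≡0 three =
    unbalanced-split p<q counts lowerP upperP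
                     (subst (q ℕ.* kN ≤_) (sym SP≡SN) lowerN) (subst (_≤ (p ℕ.+ q) ℕ.* kN) (sym SP≡SN) upperN)
    where
    kP kN SP SN : ℕ
    kP = sumℕ (λ i → isPositive (s i))
    kN = sumℕ (λ i → isNegative (s i))
    SP = sumℕ (λ i → positivePart (s i))
    SN = sumℕ (λ i → negativePart (s i))
    counts : kP ℕ.+ kN ≡ 3
    counts = trans (sym (sumℕ-distrib-+ (isPositive ∘ s) (isNegative ∘ s))) three
    lowerP : q ℕ.* kP ≤ SP
    lowerP = subst (_≤ SP) (sym (*-distribˡ-sumℕ q (isPositive ∘ s)))
                   (sumℕ-mono-≤ {k} (λ i → proj₁ (positivePart-bounds (s i) (moderate i))))
    upperP : SP ≤ (p ℕ.+ q) ℕ.* kP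
    upperP = subst (SP ≤_) (sym (*-distribˡ-sumℕ (p ℕ.+ q) (isPositive ∘ s)))
                   (sumℕ-mono-≤ {k} (λ i → proj₂ (positivePart-bounds (s i) (moderate i))))
    lowerN : q ℕ.* kN ≤ SN
    lowerN = subst (_≤ SN) (sym (*-distribˡ-sumℕ q (isNegative ∘ s)))
                   (sumℕ-mono-≤ {k} (λ i → proj₁ (negativePart-bounds (s i) (moderate i))))
    upperN : SN ≤ (p ℕ.+ q) ℕ.* kN
    upperN = subst (SN ≤_) (sym (*-distribˡ-sumℕ (p ℕ.+ q) (isNegative ∘ s)))
                   (sumℕ-mono-≤ {k} (λ i → proj₂ (negativePart-bounds (s i) (moderate i))))
    SP≡SN : SP ≡ SN
    SP≡SN = ℤ.+-injective (ℤ.i-j≡0⇒i≡j _ _ (begin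
      + SP ℤ.- + SN
        ≡⟨ cong₂ ℤ._-_ (sumℤ-pos (λ i → positivePart (s i))) (sumℤ-pos (λ i → negativePart (s i))) ⟨
      sumℤ (λ i → + positivePart (s i)) ℤ.- sumℤ (λ i → + negativePart (s i))
        ≡⟨ sumℤ-distrib-- (λ i → + positivePart (s i)) (λ i → + negativePart (s i)) ⟨
      sumℤ (λ i → + positivePart (s i) ℤ.- + negativePart (s i))
        ≡⟨ sumℤ-cong (λ i → sym (positive-negative (s i))) ⟩
      sumℤ s
        ≡⟨ sum≡0 ⟩
      0ℤ ∎))
      where open ≡-Reasoning

module Flows (G : Graph) (o : Orientation G) where
  open import Data.Nat as ℕ using (suc)
  import Data.Nat.Properties as ℕ
  open import Data.Integer using (ℤ; 0ℤ; -1ℤ; -_; _+_; _-_; _*_; _≤_; _<_)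
  open import Data.Integer.Properties
    using (+-identityʳ; +-identityˡ; *-zeroʳ; +-inverseʳ; i≡j⇒i-j≡0; i-j≡0⇒i≡j; ≤-refl; ≤-reflexive;
           ≮⇒≥; neg-mono-≤; <⇒≱; ≤∧≢⇒<; <-irrefl; <-asym; -1*i≡-i; _<?_)
    renaming (_≟_ to _≟ℤ_)
  open import Data.Integer.Divisibility.Signed using (_∣_; ∣m∣n⇒∣m-n)
  open import Data.Integer.Tactic.RingSolver using (solve-∀)
  open import Data.Fin.Properties using (any?; ¬∀⟶∃¬)
  open import Induction.WellFounded using (Acc; acc)
  open import Data.Nat.Induction using (<-wellFounded)
  open SumℕProperties using (sumℕ-mono-<)
  import Data.Bool.Properties as Bool
  open SumℤProperties

  private
    V E : Set
    V = Fin (n G)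
    E = Fin (m G)

  flowAt : (E → V) → (E → ℤ) → V → ℤ
  flowAt end f v = sumℤ (λ e → if ⌊ end e ≟ v ⌋ then f e else 0ℤ)

  inflow outflow excess : (E → ℤ) → V → ℤ
  inflow  = flowAt (head G o)
  outflow = flowAt (tail G o)
  excess f v = inflow f v - outflow f v

  conserved⇒excess≡0 : ∀ {f} → (∀ v → inflow f v ≡ outflow f v) → ∀ v → excess f v ≡ 0ℤ
  conserved⇒excess≡0 conserved v = i≡j⇒i-j≡0 (conserved v)

  excess≡0⇒conserved : ∀ {f} → (∀ v → excess f v ≡ 0ℤ) → ∀ v → inflow f v ≡ outflow f v
  excess≡0⇒conserved balanced v = i-j≡0⇒i≡j _ _ (balanced v)

  flowAt-+ : ∀ end (f g : E → ℤ) v → flowAt end (λ e → f e + g e) v ≡ flowAt end f v + flowAt end g v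
  flowAt-+ end f g v = trans (sumℤ-cong split) (sumℤ-distrib-+ {m G} _ _)
    where
    split : ∀ e → (if ⌊ end e ≟ v ⌋ then f e + g e else 0ℤ)
                ≡ (if ⌊ end e ≟ v ⌋ then f e else 0ℤ) + (if ⌊ end e ≟ v ⌋ then g e else 0ℤ)
    split e with end e ≟ v
    ... | yes _ = refl
    ... | no  _ = refl

  flowAt-* : ∀ end c (f : E → ℤ) v → flowAt end (λ e → c * f e) v ≡ c * flowAt end f v
  flowAt-* end c f v = trans (sumℤ-cong scale) (sym (*-distribˡ-sumℤ {m G} c _))
    where
    scale : ∀ e → (if ⌊ end e ≟ v ⌋ then c * f e else 0ℤ) ≡ c * (if ⌊ end e ≟ v ⌋ then f e else 0ℤ)
    scale e with end e ≟ v
    ... | yes _ = refl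
    ... | no  _ = sym (*-zeroʳ c)

  flowAt-cong : ∀ end {f g : E → ℤ} → (∀ e → f e ≡ g e) → ∀ v → flowAt end f v ≡ flowAt end g v
  flowAt-cong end f≗g v = sumℤ-cong (λ e → cong (if ⌊ end e ≟ v ⌋ then_else 0ℤ) (f≗g e))

  excess-cong : ∀ {f g} → (∀ e → f e ≡ g e) → ∀ v → excess f v ≡ excess g v
  excess-cong f≗g v = cong₂ _-_ (flowAt-cong (head G o) f≗g v) (flowAt-cong (tail G o) f≗g v)

  excess-+ : ∀ f g v → excess (λ e → f e + g e) v ≡ excess f v + excess g v
  excess-+ f g v =
    trans (cong₂ _-_ (flowAt-+ (head G o) f g v) (flowAt-+ (tail G o) f g v))
          (regroup (inflow f v) (inflow g v) (outflow f v) (outflow g v))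
    where
    regroup : ∀ a b c d → (a + b) - (c + d) ≡ (a - c) + (b - d)
    regroup = solve-∀

  excess-*ˡ : ∀ c f v → excess (λ e → c * f e) v ≡ c * excess f v
  excess-*ˡ c f v =
    trans (cong₂ _-_ (flowAt-* (head G o) c f v) (flowAt-* (tail G o) c f v))
          (factor c _ _)
    where
    factor : ∀ c a b → c * a - c * b ≡ c * (a - b)
    factor = solve-∀

  sum-flowAt-over : ∀ end (S : V → Bool) f →
    sumℤ (λ v → if S v then flowAt end f v else 0ℤ) ≡ sumℤ (λ e → if S (end e) then f e else 0ℤ)
  sum-flowAt-over end S f = begin
    sumℤ (λ v → if S v then flowAt end f v else 0ℤ)
      ≡⟨ sumℤ-cong (λ v → if-sumℤ {m G} (S v) _) ⟩
    sumℤ (λ v → sumℤ (λ e → if S v then (if ⌊ end e ≟ v ⌋ then f e else 0ℤ) else 0ℤ))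
      ≡⟨ sumℤ-comm {n G} {m G} _ ⟩
    sumℤ (λ e → sumℤ (λ v → if S v then (if ⌊ end e ≟ v ⌋ then f e else 0ℤ) else 0ℤ))
      ≡⟨ sumℤ-cong (λ e → sumℤ-cong (λ v → if-swap (S v) ⌊ end e ≟ v ⌋ (f e) 0ℤ)) ⟩
    sumℤ (λ e → sumℤ (λ v → if ⌊ end e ≟ v ⌋ then (if S v then f e else 0ℤ) else 0ℤ))
      ≡⟨ sumℤ-cong (λ e → sumℤ-select (end e) (λ v → if S v then f e else 0ℤ)) ⟩
    sumℤ (λ e → if S (end e) then f e else 0ℤ) ∎
    where open ≡-Reasoning

  excess-over : ∀ (S : V → Bool) f →
    sumℤ (λ v → if S v then excess f v else 0ℤ)
      ≡ sumℤ (λ e → (if S (head G o e) then f e else 0ℤ) - (if S (tail G o e) then f e else 0ℤ))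
  excess-over S f = begin
    sumℤ (λ v → if S v then excess f v else 0ℤ)
      ≡⟨ sumℤ-cong (λ v → if-- (S v) (inflow f v) (outflow f v)) ⟩
    sumℤ (λ v → (if S v then inflow f v else 0ℤ) - (if S v then outflow f v else 0ℤ))
      ≡⟨ sumℤ-distrib-- {n G} _ _ ⟩
    sumℤ (λ v → if S v then inflow f v else 0ℤ) - sumℤ (λ v → if S v then outflow f v else 0ℤ)
      ≡⟨ cong₂ _-_ (sum-flowAt-over (head G o) S f) (sum-flowAt-over (tail G o) S f) ⟩
    sumℤ (λ e → if S (head G o e) then f e else 0ℤ) - sumℤ (λ e → if S (tail G o e) then f e else 0ℤ)
      ≡⟨ sumℤ-distrib-- {m G} _ _ ⟨
    sumℤ (λ e → (if S (head G o e) then f e else 0ℤ) - (if S (tail G o e) then f e else 0ℤ)) ∎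
    where
    open ≡-Reasoning
    if-- : ∀ b x y → (if b then x - y else 0ℤ) ≡ (if b then x else 0ℤ) - (if b then y else 0ℤ)
    if-- true  x y = refl
    if-- false x y = refl

  sum-excess : ∀ f → sumℤ (excess f) ≡ 0ℤ
  sum-excess f = trans (excess-over (λ _ → true) f)
                       (trans (sumℤ-cong (λ e → +-inverseʳ (f e))) (sumℤ-zero (m G)))

  -- For k > 0, changing r e by +k (along) or -k (against) moves k units of excess from x to y,
  -- and keeps |r e| < k if it was.
  data Residual (r : E → ℤ) : E → V → V → Set where
    along   : ∀ {e} → r e < 0ℤ → Residual r e (tail G o e) (head G o e)
    against : ∀ {e} → 0ℤ < r e → Residual r e (head G o e) (tail G o e)

  Exits : (E → ℤ) → (V → Bool) → E → Set
  Exits r S e = (r e < 0ℤ × S (tail G o e) ≡ true × S (head G o e) ≡ false)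
              ⊎ (0ℤ < r e × S (head G o e) ≡ true × S (tail G o e) ≡ false)

  exits? : ∀ r S e → Dec (Exits r S e)
  exits? r S e = (r e <? 0ℤ ×-dec S (tail G o e) Bool.≟ true ×-dec S (head G o e) Bool.≟ false)
           ⊎-dec (0ℤ <? r e ×-dec S (head G o e) Bool.≟ true ×-dec S (tail G o e) Bool.≟ false)

  exit⇒residual : ∀ {r S e} → Exits r S e →
    ∃ λ x → ∃ λ y → Residual r e x y × S x ≡ true × S y ≡ false
  exit⇒residual (inj₁ (neg , Sx , Sy)) = _ , _ , along neg , Sx , Sy
  exit⇒residual (inj₂ (pos , Sx , Sy)) = _ , _ , against pos , Sx , Sy

  closed⇒excess-over≤0 : ∀ {r} (S : V → Bool) → (∀ e → ¬ Exits r S e) →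
    sumℤ (λ v → if S v then excess r v else 0ℤ) ≤ 0ℤ
  closed⇒excess-over≤0 {r} S closed =
    subst (_≤ 0ℤ) (sym (excess-over S r))
          (subst (sumℤ crossing ≤_) (sumℤ-zero (m G)) (sumℤ-mono-≤ edge≤0))
    where
    crossing : E → ℤ
    crossing e = (if S (head G o e) then r e else 0ℤ) - (if S (tail G o e) then r e else 0ℤ)
    edge≤0 : ∀ e → crossing e ≤ 0ℤ
    edge≤0 e with S (head G o e) in Sh | S (tail G o e) in St
    ... | true  | true  = ≤-reflexive (+-inverseʳ (r e))
    ... | true  | false = subst (_≤ 0ℤ) (sym (+-identityʳ (r e)))
                                (≮⇒≥ λ pos → closed e (inj₂ (pos , Sh , St)))
    ... | false | true  = subst (_≤ 0ℤ) (sym (+-identityˡ (- r e)))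
                                (neg-mono-≤ (≮⇒≥ λ neg → closed e (inj₁ (neg , St , Sh))))
    ... | false | false = ≤-refl

  infixr 5 _∷_
  data AugmentingPath (r : E → ℤ) : V → Set where
    deficit : ∀ {x} → excess r x < 0ℤ → AugmentingPath r x
    _∷_     : ∀ {e x y} → Residual r e x y → AugmentingPath r y → AugmentingPath r x

  length : ∀ {r x} → AugmentingPath r x → ℕ
  length (deficit _) = 0
  length (_ ∷ w)     = suc (length w)

  outside : (V → Bool) → ℕ
  outside S = sumℕ (λ v → if S v then 0 else 1)

  -- Grow the set of vertices reachable from x by residual edges: it cannot close up
  -- without meeting a deficit, since a closed set has nonpositive total excess.
  augmentingPath : ∀ {r x} → 0ℤ < excess r x → AugmentingPath r x
  augmentingPath {r} {x} surplus = grow (λ v → ⌊ v ≟ x ⌋) (<-wellFounded _) (≟-refl x) start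
    where
    start : ∀ {z} → ⌊ z ≟ x ⌋ ≡ true → AugmentingPath r z → AugmentingPath r x
    start {z} z≟x w with z ≟ x
    ... | yes refl = w

    grow : ∀ (S : V → Bool) → Acc ℕ._<_ (outside S) → S x ≡ true →
           (∀ {z} → S z ≡ true → AugmentingPath r z → AugmentingPath r x) → AugmentingPath r x
    grow S (acc smaller) Sx extend with any? (λ z → S z Bool.≟ true ×-dec excess r z <? 0ℤ)
    ... | yes (z , Sz , neg) = extend Sz (deficit neg)
    ... | no no-deficit with any? (exits? r S)
    ...   | no closed = ⊥-elim (<⇒≱ positive (closed⇒excess-over≤0 S (λ e ex → closed (e , ex))))
      where
      inS : V → ℤ
      inS v = if S v then excess r v else 0ℤ
      nonneg : ∀ v → 0ℤ ≤ inS v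
      nonneg v with S v in Sv
      ... | true  = ≮⇒≥ (λ neg → no-deficit (v , Sv , neg))
      ... | false = ≤-refl
      surplus-in-S : 0ℤ < inS x
      surplus-in-S rewrite Sx = surplus
      positive : 0ℤ < sumℤ inS
      positive = subst (_< sumℤ inS) (sumℤ-zero (n G)) (sumℤ-mono-< x nonneg surplus-in-S)
    ...   | yes (e , exit) with exit⇒residual {r} {S} exit
    ...     | a , c , ρ , Sa , Sc = grow S′ (smaller shrinks) (cong (_∨ ⌊ x ≟ c ⌋) Sx) extend′
      where
      S′ : V → Bool
      S′ v = S v ∨ ⌊ v ≟ c ⌋
      shrinks : outside S′ ℕ.< outside S
      shrinks = sumℕ-mono-< c pointwise newly-inside
        where
        newly-inside : (if S′ c then 0 else 1) ℕ.< (if S c then 0 else 1)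
        newly-inside rewrite ≟-refl c | Bool.∨-zeroʳ (S c) | Sc = ℕ.≤-refl
        pointwise : ∀ v → (if S′ v then 0 else 1) ℕ.≤ (if S v then 0 else 1)
        pointwise v with S v | ⌊ v ≟ c ⌋
        ... | true  | _     = ℕ.≤-refl
        ... | false | true  = ℕ.z≤n
        ... | false | false = ℕ.≤-refl
      extend′ : ∀ {z} → S′ z ≡ true → AugmentingPath r z → AugmentingPath r x
      extend′ {z} S′z w with S z in Sz
      ... | true = extend Sz w
      ... | false with z ≟ c
      ...   | yes refl = extend Sa (ρ ∷ w)

  surplus-vertex : ∀ {r} → ¬ (∀ v → excess r v ≡ 0ℤ) → ∃ λ x → 0ℤ < excess r x
  surplus-vertex {r} unbalanced with any? (λ v → 0ℤ <? excess r v)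
  ... | yes found = found
  ... | no none   = ⊥-elim (<-irrefl (sum-excess r) negative)
    where
    nonpos : ∀ v → excess r v ≤ 0ℤ
    nonpos v = ≮⇒≥ (λ pos → none (v , pos))
    negative : sumℤ (excess r) < 0ℤ
    negative with ¬∀⟶∃¬ (n G) _ (λ v → excess r v ≟ℤ 0ℤ) unbalanced
    ... | v , ≢0 = subst (sumℤ (excess r) <_) (sumℤ-zero (n G)) (sumℤ-mono-< v nonpos (≤∧≢⇒< (nonpos v) ≢0))

  excess-neg : ∀ f v → excess (λ e → - f e) v ≡ - excess f v
  excess-neg f v = begin
    excess (λ e → - f e) v     ≡⟨ excess-cong (λ e → sym (-1*i≡-i (f e))) v ⟩
    excess (λ e → -1ℤ * f e) v ≡⟨ excess-*ˡ -1ℤ f v ⟩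
    -1ℤ * excess f v           ≡⟨ -1*i≡-i _ ⟩
    - excess f v               ∎
    where open ≡-Reasoning

  excess-- : ∀ f g v → excess (λ e → f e - g e) v ≡ excess f v - excess g v
  excess-- f g v = trans (excess-+ f (λ e → - g e) v) (cong (_+_ (excess f v)) (excess-neg g v))

  ∣-excess : ∀ {d f} → (∀ e → d ∣ f e) → ∀ v → d ∣ excess f v
  ∣-excess {d} {f} d∣f v = ∣m∣n⇒∣m-n (∣-flowAt (head G o)) (∣-flowAt (tail G o))
    where
    ∣-flowAt : ∀ end → d ∣ flowAt end f v
    ∣-flowAt end = ∣-sumℤ d∣masked
      where
      d∣masked : ∀ e → d ∣ (if ⌊ end e ≟ v ⌋ then f e else 0ℤ)
      d∣masked e with end e ≟ v
      ... | yes _ = d∣f e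
      ... | no  _ = ∣0 d

  bump : (E → ℤ) → E → ℤ → E → ℤ
  bump r e a e′ = r e′ + (if ⌊ e ≟ e′ ⌋ then a else 0ℤ)

  bump-elsewhere : ∀ r {e e′} a → e ≢ e′ → bump r e a e′ ≡ r e′
  bump-elsewhere r a e≢e′ rewrite ≢⇒≟-false e≢e′ = +-identityʳ _

  excess-bump : ∀ r e a v → excess (bump r e a) v
              ≡ excess r v + ((if ⌊ head G o e ≟ v ⌋ then a else 0ℤ) - (if ⌊ tail G o e ≟ v ⌋ then a else 0ℤ))
  excess-bump r e a v =
    trans (excess-+ r _ v) (cong (_+_ (excess r v)) (cong₂ _-_ (flowAt-unit (head G o)) (flowAt-unit (tail G o))))
    where
    flowAt-unit : ∀ end →
      flowAt end (λ e′ → if ⌊ e ≟ e′ ⌋ then a else 0ℤ) v ≡ (if ⌊ end e ≟ v ⌋ then a else 0ℤ)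
    flowAt-unit end = trans (sumℤ-cong (λ e′ → if-swap ⌊ end e′ ≟ v ⌋ ⌊ e ≟ e′ ⌋ a 0ℤ))
                            (sumℤ-select e (λ e′ → if ⌊ end e′ ≟ v ⌋ then a else 0ℤ))

  residual-start : ∀ {r e x y a b} → Residual r e x y → Residual r e a b → a ≡ x
  residual-start (along _)     (along _)     = refl
  residual-start (along neg)   (against pos) = ⊥-elim (<-asym neg pos)
  residual-start (against pos) (along neg)   = ⊥-elim (<-asym neg pos)
  residual-start (against _)   (against _)   = refl

  residual-subst : ∀ {r r′ e x y} → r′ e ≡ r e → Residual r e x y → Residual r′ e x y
  residual-subst eq (along neg)   = along (subst (_< 0ℤ) (sym eq) neg)
  residual-subst eq (against pos) = against (subst (0ℤ <_) (sym eq) pos)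

  Avoids : ∀ {r z} → V → AugmentingPath r z → Set
  Avoids x (deficit {z} _)   = z ≢ x
  Avoids x (_∷_ {x = z} _ w) = z ≢ x × Avoids x w

  revisit : ∀ {r z} x (w : AugmentingPath r z) →
            (Σ (AugmentingPath r x) λ w′ → length w′ ℕ.≤ length w) ⊎ Avoids x w
  revisit x (deficit {z} neg) with z ≟ x
  ... | yes refl = inj₁ (deficit neg , ℕ.≤-refl)
  ... | no  z≢x  = inj₂ z≢x
  revisit x (_∷_ {x = z} ρ w) with z ≟ x
  ... | yes refl = inj₁ (ρ ∷ w , ℕ.≤-refl)
  ... | no  z≢x with revisit x w
  ...   | inj₁ (w′ , shorter) = inj₁ (w′ , ℕ.m≤n⇒m≤1+n shorter)
  ...   | inj₂ avoids         = inj₂ (z≢x , avoids)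

  transfer : ∀ {r r′ e x y} → Residual r e x y → (∀ {e′} → e ≢ e′ → r′ e′ ≡ r e′) →
             (∀ {z} → z ≢ x → excess r z < 0ℤ → excess r′ z < 0ℤ) →
             ∀ {z} (w : AugmentingPath r z) → Avoids x w →
             Σ (AugmentingPath r′ z) λ w′ → length w′ ≡ length w
  transfer ρ unchanged deficits-kept (deficit neg) z≢x = deficit (deficits-kept z≢x neg) , refl
  transfer {e = e} ρ unchanged deficits-kept (_∷_ {e′} σ w) (z≢x , avoids) =
    let w′ , same-length = transfer ρ unchanged deficits-kept w avoids
    in residual-subst (unchanged e≢e′) σ ∷ w′ , cong suc same-length
    where
    e≢e′ : e ≢ e′
    e≢e′ refl = z≢x (residual-start ρ σ)

module ModularFlow (G : Graph) (o : Orientation G) (k : ℕ) .{{_ : NonZero k}} where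
  open import Data.Nat as ℕ using (suc)
  import Data.Nat.Properties as ℕ
  open import Data.Integer using (ℤ; +_; 0ℤ; -_; _+_; _-_; ∣_∣; _≤_; _<_; +<+; _%ℕ_; _/ℕ_)
  open import Data.Integer.Properties using (+-identityʳ; <-asym; ≮⇒≥; _<?_; +-mono-≤-<)
    renaming (_≟_ to _≟ℤ_)
  open import Data.Integer.DivMod using (n%ℕd<d; a≡a%ℕn+[a/ℕn]*n)
  open import Data.Integer.Divisibility.Signed using (_∣_; divides; ∣m∣n⇒∣m-n; ∣m⇒∣-m; ∣-refl)
  open import Data.Integer.Tactic.RingSolver using (solve-∀)
  open import Data.Fin.Properties using (all?)
  open import Induction.WellFounded using (Acc; acc)
  open import Data.Nat.Induction using (<-wellFounded)
  open Flows G o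
  open Arithmetic
  open SumℕProperties using (sumℕ-cong; sumℕ-+-select)
  open SumℤProperties using (∣0)

  private
    V E : Set
    V = Fin (n G)
    E = Fin (m G)

  module Lifting (h : E → ℤ) (h-modular : ∀ v → + k ∣ excess h v) where

    record Rounding (r : E → ℤ) : Set where
      field
        bounded   : ∀ e → ∣ r e ∣ ℕ.< k
        congruent : ∀ e → + k ∣ h e - r e
    open Rounding

    rounding-excess : ∀ {r} → Rounding r → ∀ v → + k ∣ excess r v
    rounding-excess {r} R v =
      subst (+ k ∣_) cancel (∣m∣n⇒∣m-n (h-modular v) (∣-excess (congruent R) v))
      where
      cancel : excess h v - excess (λ e → h e - r e) v ≡ excess r v
      cancel = trans (cong (_-_ (excess h v)) (excess-- h r v)) (a-[a-b]≡b (excess h v) (excess r v))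
        where
        a-[a-b]≡b : ∀ a b → a - (a - b) ≡ b
        a-[a-b]≡b = solve-∀

    initial : Rounding (λ e → + (h e %ℕ k))
    initial = record
      { bounded   = λ e → n%ℕd<d (h e) k
      ; congruent = λ e → divides (h e /ℕ k) (a≡b+c⇒a-b≡c (a≡a%ℕn+[a/ℕn]*n (h e) k))
      }
      where
      a≡b+c⇒a-b≡c : ∀ {a b c} → a ≡ b + c → a - b ≡ c
      a≡b+c⇒a-b≡c {b = b} {c} refl = b+c-b≡c b c
        where
        b+c-b≡c : ∀ b c → b + c - b ≡ c
        b+c-b≡c = solve-∀

    push : ∀ {r e x y} → Residual r e x y → E → ℤ
    push {r} {e} (along _)   = bump r e (+ k)
    push {r} {e} (against _) = bump r e (- + k)

    push-elsewhere : ∀ {r e x y} (ρ : Residual r e x y) {e′} → e ≢ e′ → push ρ e′ ≡ r e′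
    push-elsewhere {r} (along _)   = bump-elsewhere r (+ k)
    push-elsewhere {r} (against _) = bump-elsewhere r (- + k)

    kAt : V → V → ℤ
    kAt x v = if ⌊ x ≟ v ⌋ then + k else 0ℤ

    excess-push : ∀ {r e x y} (ρ : Residual r e x y) v → excess (push ρ) v + kAt x v ≡ excess r v + kAt y v
    excess-push {r} {e} (along _) v =
      trans (cong (_+ kAt (tail G o e) v) (excess-bump r e (+ k) v))
            (a+[b-c]+c≡a+b (excess r v) (kAt (head G o e) v) (kAt (tail G o e) v))
      where
      a+[b-c]+c≡a+b : ∀ a b c → a + (b - c) + c ≡ a + b
      a+[b-c]+c≡a+b = solve-∀
    excess-push {r} {e} (against _) v =
      trans (cong (_+ kAt (head G o e) v)
                  (trans (excess-bump r e (- + k) v)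
                         (cong (_+_ (excess r v))
                               (cong₂ _-_ (if-neg ⌊ head G o e ≟ v ⌋) (if-neg ⌊ tail G o e ≟ v ⌋)))))
            (a+[-b+c]+b≡a+c (excess r v) (kAt (head G o e) v) (kAt (tail G o e) v))
      where
      if-neg : ∀ b → (if b then - + k else 0ℤ) ≡ - (if b then + k else 0ℤ)
      if-neg true  = refl
      if-neg false = refl
      a+[-b+c]+b≡a+c : ∀ a b c → a + (- b - - c) + b ≡ a + c
      a+[-b+c]+b≡a+c = solve-∀

    kAt-self : ∀ x → kAt x x ≡ + k
    kAt-self x rewrite ≟-refl x = refl

    kAt-≢ : ∀ {x v} → x ≢ v → kAt x v ≡ 0ℤ
    kAt-≢ x≢v rewrite ≢⇒≟-false x≢v = refl

    excess-push-at : ∀ {r e x y} (ρ : Residual r e x y) v → excess (push ρ) v ≡ excess r v + kAt y v - kAt x v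
    excess-push-at {r} {x = x} {y} ρ v = begin
      excess (push ρ) v                       ≡⟨ a≡a+b-b (excess (push ρ) v) (kAt x v) ⟩
      excess (push ρ) v + kAt x v - kAt x v   ≡⟨ cong (_- kAt x v) (excess-push ρ v) ⟩
      excess r v + kAt y v - kAt x v          ∎
      where
      open ≡-Reasoning
      a≡a+b-b : ∀ a b → a ≡ a + b - b
      a≡a+b-b = solve-∀

    excess-push-source : ∀ {r e x y} (ρ : Residual r e x y) → x ≢ y → excess (push ρ) x ≡ excess r x - + k
    excess-push-source {r} {x = x} {y} ρ x≢y = begin
      excess (push ρ) x                   ≡⟨ excess-push-at ρ x ⟩
      excess r x + kAt y x - kAt x x      ≡⟨ cong₂ (λ a b → excess r x + a - b) (kAt-≢ (x≢y ∘ sym)) (kAt-self x) ⟩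
      excess r x + 0ℤ - + k               ≡⟨ cong (_- + k) (+-identityʳ (excess r x)) ⟩
      excess r x - + k                    ∎
      where open ≡-Reasoning

    excess-push-target : ∀ {r e x y} (ρ : Residual r e x y) → x ≢ y → excess (push ρ) y ≡ excess r y + + k
    excess-push-target {r} {x = x} {y} ρ x≢y = begin
      excess (push ρ) y                   ≡⟨ excess-push-at ρ y ⟩
      excess r y + kAt y y - kAt x y      ≡⟨ cong₂ (λ a b → excess r y + a - b) (kAt-self y) (kAt-≢ x≢y) ⟩
      excess r y + + k - 0ℤ               ≡⟨ +-identityʳ _ ⟩
      excess r y + + k                    ∎
      where open ≡-Reasoning

    excess-push-other : ∀ {r e x y} (ρ : Residual r e x y) {v} → x ≢ v → y ≢ v → excess (push ρ) v ≡ excess r v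
    excess-push-other {r} {x = x} {y} ρ {v} x≢v y≢v = begin
      excess (push ρ) v                   ≡⟨ excess-push-at ρ v ⟩
      excess r v + kAt y v - kAt x v      ≡⟨ cong₂ (λ a b → excess r v + a - b) (kAt-≢ y≢v) (kAt-≢ x≢v) ⟩
      excess r v + 0ℤ - 0ℤ                ≡⟨ trans (+-identityʳ _) (+-identityʳ _) ⟩
      excess r v                          ∎
      where open ≡-Reasoning

    bump-rounding : ∀ {r e a} → Rounding r → + k ∣ a → ∣ r e + a ∣ ℕ.< k → Rounding (bump r e a)
    bump-rounding {r} {e} {a} R k∣a bounded-at-e = record { bounded = bounded′ ; congruent = congruent′ }
      where
      bounded′ : ∀ e′ → ∣ bump r e a e′ ∣ ℕ.< k
      bounded′ e′ with e ≟ e′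
      ... | yes refl = bounded-at-e
      ... | no  _    = subst (λ t → ∣ t ∣ ℕ.< k) (sym (+-identityʳ (r e′))) (bounded R e′)
      congruent′ : ∀ e′ → + k ∣ h e′ - bump r e a e′
      congruent′ e′ = subst (+ k ∣_) (a-b-c≡a-[b+c] (h e′) (r e′) _)
                            (∣m∣n⇒∣m-n (congruent R e′) k∣masked)
        where
        a-b-c≡a-[b+c] : ∀ a b c → a - b - c ≡ a - (b + c)
        a-b-c≡a-[b+c] = solve-∀
        k∣masked : + k ∣ (if ⌊ e ≟ e′ ⌋ then a else 0ℤ)
        k∣masked with e ≟ e′
        ... | yes _ = k∣a
        ... | no  _ = ∣0 (+ k)

    push-rounding : ∀ {r e x y} → Rounding r → (ρ : Residual r e x y) → Rounding (push ρ)
    push-rounding R (along neg)   = bump-rounding R ∣-refl (∣i+k∣<k neg (bounded R _))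
    push-rounding R (against pos) = bump-rounding R (∣m⇒∣-m ∣-refl) (∣i-k∣<k pos (bounded R _))

    imbalance : (E → ℤ) → ℕ
    imbalance r = sumℕ (λ v → ∣ excess r v ∣)

    kAtℕ : V → V → ℕ
    kAtℕ x v = if ⌊ x ≟ v ⌋ then k else 0

    push-into-deficit : ∀ {r e x y} → Rounding r → (ρ : Residual r e x y) → x ≢ y →
                        0ℤ < excess r x → excess r y < 0ℤ → imbalance (push ρ) ℕ.< imbalance r
    push-into-deficit {r} {x = x} {y} R ρ x≢y surplus deficient =
      subst (imbalance (push ρ) ℕ.<_) total
            (ℕ.<-≤-trans (ℕ.m<m+n _ (ℕ.>-nonZero⁻¹ k)) (ℕ.m≤m+n _ k))
      where
      pointwise : ∀ v → ∣ excess (push ρ) v ∣ ℕ.+ kAtℕ x v ℕ.+ kAtℕ y v ≡ ∣ excess r v ∣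
      pointwise v with x ≟ v | y ≟ v
      ... | yes refl | yes refl = ⊥-elim (x≢y refl)
      ... | yes refl | no _ =
        trans (ℕ.+-identityʳ _)
              (trans (cong (λ t → ∣ t ∣ ℕ.+ k) (excess-push-source ρ x≢y))
                     (∣i-k∣+k≡∣i∣ (∣∧pos⇒≥ (rounding-excess R x) surplus)))
      ... | no _ | yes refl =
        trans (cong (λ t → t ℕ.+ k) (ℕ.+-identityʳ _))
              (trans (cong (λ t → ∣ t ∣ ℕ.+ k) (excess-push-target ρ x≢y))
                     (∣i+k∣+k≡∣i∣ {excess r y} (∣∧neg⇒≤- (rounding-excess R y) deficient)))
      ... | no x≢v | no y≢v =
        trans (ℕ.+-identityʳ _) (trans (ℕ.+-identityʳ _) (cong ∣_∣ (excess-push-other ρ x≢v y≢v)))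
      total : imbalance (push ρ) ℕ.+ k ℕ.+ k ≡ imbalance r
      total = begin
        imbalance (push ρ) ℕ.+ k ℕ.+ k
          ≡⟨ cong (ℕ._+ k) (sumℕ-+-select _ x k) ⟨
        sumℕ (λ v → ∣ excess (push ρ) v ∣ ℕ.+ kAtℕ x v) ℕ.+ k
          ≡⟨ sumℕ-+-select _ y k ⟨
        sumℕ (λ v → ∣ excess (push ρ) v ∣ ℕ.+ kAtℕ x v ℕ.+ kAtℕ y v)
          ≡⟨ sumℕ-cong pointwise ⟩
        imbalance r ∎
        where open ≡-Reasoning

    push-into-surplus : ∀ {r e x y} → Rounding r → (ρ : Residual r e x y) → x ≢ y →
                        0ℤ < excess r x → 0ℤ ≤ excess r y → imbalance (push ρ) ≡ imbalance r
    push-into-surplus {r} {x = x} {y} R ρ x≢y surplus nonneg =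
      ℕ.+-cancelʳ-≡ k _ _ (trans (sym (sumℕ-+-select _ x k))
                                 (trans (sumℕ-cong pointwise) (sumℕ-+-select _ y k)))
      where
      pointwise : ∀ v → ∣ excess (push ρ) v ∣ ℕ.+ kAtℕ x v ≡ ∣ excess r v ∣ ℕ.+ kAtℕ y v
      pointwise v with x ≟ v | y ≟ v
      ... | yes refl | yes refl = ⊥-elim (x≢y refl)
      ... | yes refl | no _ =
        trans (cong (λ t → ∣ t ∣ ℕ.+ k) (excess-push-source ρ x≢y))
              (trans (∣i-k∣+k≡∣i∣ (∣∧pos⇒≥ (rounding-excess R x) surplus)) (sym (ℕ.+-identityʳ _)))
      ... | no _ | yes refl =
        trans (ℕ.+-identityʳ _) (trans (cong ∣_∣ (excess-push-target ρ x≢y)) (∣i+k∣≡∣i∣+k k nonneg))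
      ... | no x≢v | no y≢v =
        trans (ℕ.+-identityʳ _) (trans (cong ∣_∣ (excess-push-other ρ x≢v y≢v)) (sym (ℕ.+-identityʳ _)))

    -- Push k along the first edge. Unless it reaches a deficit, the imbalance is unchanged and
    -- the rest of the path, which after shortcutting avoids x, is augmenting for the pushed function.
    improve : ∀ {r x} (w : AugmentingPath r x) → Acc ℕ._<_ (length w) → Rounding r → 0ℤ < excess r x →
              ∃ λ r′ → Rounding r′ × imbalance r′ ℕ.< imbalance r
    improve (deficit neg) _ _ surplus = ⊥-elim (<-asym neg surplus)
    improve {r} {x} (_∷_ {y = y} ρ w) (acc shorter) R surplus with x ≟ y
    ... | yes refl = improve w (shorter ℕ.≤-refl) R surplus
    ... | no x≢y with revisit x w
    ...   | inj₁ (w′ , w′≤w) = improve w′ (shorter (ℕ.s≤s w′≤w)) R surplus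
    ...   | inj₂ avoids with excess r y <? 0ℤ
    ...     | yes deficient = push ρ , push-rounding R ρ , push-into-deficit R ρ x≢y surplus deficient
    ...     | no ¬deficient =
      let r′ , R′ , smaller = improve w₁ (shorter (ℕ.≤-reflexive (cong suc same-length)))
                                       (push-rounding R ρ) surplus₁
      in r′ , R′ , subst (imbalance r′ ℕ.<_) (push-into-surplus R ρ x≢y surplus nonneg) smaller
      where
      nonneg : 0ℤ ≤ excess r y
      nonneg = ≮⇒≥ ¬deficient
      surplus₁ : 0ℤ < excess (push ρ) y
      surplus₁ = subst (0ℤ <_) (sym (excess-push-target ρ x≢y)) (+-mono-≤-< nonneg (+<+ (ℕ.>-nonZero⁻¹ k)))
      deficits-kept : ∀ {z} → z ≢ x → excess r z < 0ℤ → excess (push ρ) z < 0ℤ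
      deficits-kept {z} z≢x neg =
        subst (_< 0ℤ) (sym (excess-push-other ρ (z≢x ∘ sym) λ { refl → ¬deficient neg })) neg
      w₁ : AugmentingPath (push ρ) y
      w₁ = proj₁ (transfer ρ (push-elsewhere ρ) deficits-kept w avoids)
      same-length : length w₁ ≡ length w
      same-length = proj₂ (transfer ρ (push-elsewhere ρ) deficits-kept w avoids)

    balance : ∀ {r} → Acc ℕ._<_ (imbalance r) → Rounding r →
              ∃ λ r′ → Rounding r′ × (∀ v → excess r′ v ≡ 0ℤ)
    balance {r} (acc smaller) R with all? (λ v → excess r v ≟ℤ 0ℤ)
    ... | yes balanced = r , R , balanced
    ... | no unbalanced =
      let x , surplus = surplus-vertex unbalanced
          w = augmentingPath surplus
          r′ , R′ , decreased = improve w (<-wellFounded (length w)) R surplus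
      in balance (smaller decreased) R′

  lift-modular-flow : ∀ h → (∀ v → + k ∣ excess h v) →
                      ∃ λ r → IsFlow G k o r × (∀ e → + k ∣ h e - r e)
  lift-modular-flow h h-modular =
    let r , R , balanced = balance (<-wellFounded _) initial
    in r , (bounded R , excess≡0⇒conserved balanced) , congruent R
    where
    open Lifting h h-modular
    open Rounding

Loopless : Graph → Set
Loopless G = ∀ e → src G e ≢ tgt G e

module Incidence (G : Graph) (o : Orientation G) where
  open import Data.Nat as ℕ using (suc)
  import Data.Nat.Properties as ℕ
  open import Data.Integer using (ℤ; +_; -[1+_]; 0ℤ; 1ℤ; -_; _+_; _-_; _*_; ∣_∣)
  open import Data.Integer.Properties
    using (+-identityʳ; +-identityˡ; *-identityˡ; *-identityʳ; *-zeroˡ; *-zeroʳ; +-inverseʳ; pos-*;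
           ∣-i∣≡∣i∣; ∣i∣≡0⇒i≡0)
    renaming (_≟_ to _≟ℤ_)
  import Data.Nat.Divisibility as ℕ
  open import Data.Integer.Divisibility.Signed
    using (_∣_; divides; ∣⇒∣ᵤ; ∣m∣n⇒∣m-n; ∣m∣n⇒∣m+n; ∣m⇒∣m*n; ∣n⇒∣m*n; ∣-refl)
  open import Data.Integer.Tactic.RingSolver using (solve-∀)
  open Flows G o
  open SumℕProperties using (sumℕ-cong; sumℕ-distrib-+; sumℕ≡0⇒≡0)
  open SumℤProperties
  open BalancedTriples
  open Arithmetic using (<+1⇒≤)

  private
    V E : Set
    V = Fin (n G)
    E = Fin (m G)

  endsAt : E → V → ℕ
  endsAt e v = (if ⌊ src G e ≟ v ⌋ then 1 else 0) ℕ.+ (if ⌊ tgt G e ≟ v ⌋ then 1 else 0)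

  endsAt-oriented : ∀ e v →
    endsAt e v ≡ (if ⌊ head G o e ≟ v ⌋ then 1 else 0) ℕ.+ (if ⌊ tail G o e ≟ v ⌋ then 1 else 0)
  endsAt-oriented e v with o e
  ... | true  = ℕ.+-comm (if ⌊ src G e ≟ v ⌋ then 1 else 0) _
  ... | false = refl

  head≢tail : Loopless G → ∀ e → head G o e ≢ tail G o e
  head≢tail loopless e with o e
  ... | true  = loopless e ∘ sym
  ... | false = loopless e

  inflow+outflow : ∀ f v → inflow f v + outflow f v ≡ sumℤ (λ e → + endsAt e v * f e)
  inflow+outflow f v = trans (sym (sumℤ-distrib-+ {m G} _ _)) (sumℤ-cong weigh)
    where
    indicators : ∀ a b x → (if a then x else 0ℤ) + (if b then x else 0ℤ)
                         ≡ + ((if a then 1 else 0) ℕ.+ (if b then 1 else 0)) * x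
    indicators true  true  x = double x
      where
      double : ∀ x → x + x ≡ + 2 * x
      double = solve-∀
    indicators true  false x = trans (+-identityʳ x) (sym (*-identityˡ x))
    indicators false true  x = trans (+-identityˡ x) (sym (*-identityˡ x))
    indicators false false x = sym (*-zeroˡ x)
    weigh : ∀ e → (if ⌊ head G o e ≟ v ⌋ then f e else 0ℤ) + (if ⌊ tail G o e ≟ v ⌋ then f e else 0ℤ)
                ≡ + endsAt e v * f e
    weigh e = trans (indicators ⌊ head G o e ≟ v ⌋ ⌊ tail G o e ≟ v ⌋ (f e))
                    (cong (λ c → + c * f e) (sym (endsAt-oriented e v)))

  2∣inflow+outflow⇒2∣excess : ∀ {f v} → + 2 ∣ inflow f v + outflow f v → + 2 ∣ excess f v
  2∣inflow+outflow⇒2∣excess {f} {v} 2∣sum =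
    subst (+ 2 ∣_) (sum-minus-twice (inflow f v) (outflow f v)) (∣m∣n⇒∣m-n 2∣sum (∣m⇒∣m*n (outflow f v) ∣-refl))
    where
    sum-minus-twice : ∀ a b → a + b - + 2 * b ≡ a - b
    sum-minus-twice = solve-∀

  conserved⇒2∣inflow+outflow : ∀ {f v} → inflow f v ≡ outflow f v → + 2 ∣ inflow f v + outflow f v
  conserved⇒2∣inflow+outflow {f} {v} conserved =
    divides (outflow f v) (trans (cong (_+ outflow f v) conserved) (double (outflow f v)))
    where
    double : ∀ x → x + x ≡ x * + 2
    double = solve-∀

  complement-of-perfect-matching-is-even : Cubic G → ∀ {M} → PerfectMatching G M →
    ∀ v → + 2 ∣ excess (λ e → if M e then 0ℤ else 1ℤ) v
  complement-of-perfect-matching-is-even cubic {M} perfect v =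
    2∣inflow+outflow⇒2∣excess (subst (+ 2 ∣_) (sym in+out≡2) ∣-refl)
    where
    indicator : E → ℤ
    indicator e = if M e then 0ℤ else 1ℤ
    matched unmatched : E → ℕ
    matched   e = if M e then endsAt e v else 0
    unmatched e = if M e then 0 else endsAt e v
    split : ∀ e → matched e ℕ.+ unmatched e ≡ endsAt e v
    split e with M e
    ... | true  = ℕ.+-identityʳ _
    ... | false = refl
    unmatched-ends : sumℕ unmatched ≡ 2
    unmatched-ends = ℕ.+-cancelˡ-≡ 1 _ 2 (begin
      1 ℕ.+ sumℕ unmatched                ≡⟨ cong (ℕ._+ sumℕ unmatched) (perfect v) ⟨
      sumℕ matched ℕ.+ sumℕ unmatched     ≡⟨ sumℕ-distrib-+ matched unmatched ⟨
      sumℕ (λ e → matched e ℕ.+ unmatched e) ≡⟨ trans (sumℕ-cong split) (cubic v) ⟩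
      3                                   ∎)
      where open ≡-Reasoning
    weigh : ∀ e → + endsAt e v * indicator e ≡ + unmatched e
    weigh e with M e
    ... | true  = *-zeroʳ (+ endsAt e v)
    ... | false = *-identityʳ (+ endsAt e v)
    in+out≡2 : inflow indicator v + outflow indicator v ≡ + 2
    in+out≡2 = trans (inflow+outflow indicator v)
                     (trans (sumℤ-cong weigh) (trans (sumℤ-pos unmatched) (cong +_ unmatched-ends)))

  zeros+nonzeros≡degree : ∀ (φ₂ : E → ℤ) → (∀ e → ∣ φ₂ e ∣ ℕ.< 2) → ∀ v →
    sumℕ (λ e → if ⌊ φ₂ e ≟ℤ 0ℤ ⌋ then endsAt e v else 0) ℕ.+ sumℕ (λ e → endsAt e v ℕ.* ∣ φ₂ e ∣)
      ≡ degree G v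
  zeros+nonzeros≡degree φ₂ bounded v =
    trans (sym (sumℕ-distrib-+ (λ e → if ⌊ φ₂ e ≟ℤ 0ℤ ⌋ then endsAt e v else 0)
                               (λ e → endsAt e v ℕ.* ∣ φ₂ e ∣)))
          (sumℕ-cong (λ e → split (φ₂ e) (bounded e)))
    where
    split : ∀ {a} x → ∣ x ∣ ℕ.< 2 → (if ⌊ x ≟ℤ 0ℤ ⌋ then a else 0) ℕ.+ a ℕ.* ∣ x ∣ ≡ a
    split {a} (+ 0)       _ = trans (cong (a ℕ.+_) (ℕ.*-zeroʳ a)) (ℕ.+-identityʳ a)
    split {a} (+ 1)       _ = ℕ.*-identityʳ a
    split {a} -[1+ 0 ]    _ = ℕ.*-identityʳ a
    split (+ suc (suc _)) (ℕ.s≤s (ℕ.s≤s ()))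
    split -[1+ suc _ ]    (ℕ.s≤s (ℕ.s≤s ()))

  2∣nonzeros : ∀ {φ₂ v} → inflow φ₂ v ≡ outflow φ₂ v → + 2 ∣ + sumℕ (λ e → endsAt e v ℕ.* ∣ φ₂ e ∣)
  2∣nonzeros {φ₂} {v} conserved =
    subst (+ 2 ∣_) total
          (∣m∣n⇒∣m+n 2∣in+out (∣-sumℤ (λ e → ∣n⇒∣m*n (+ endsAt e v) (2∣∣i∣-i (φ₂ e)))))
    where
    2∣∣i∣-i : ∀ i → + 2 ∣ + ∣ i ∣ - i
    2∣∣i∣-i (+ n)    = divides 0ℤ (+-inverseʳ (+ n))
    2∣∣i∣-i -[1+ n ] = divides (+ suc n) (x--x≡x*2 (+ suc n))
      where
      x--x≡x*2 : ∀ x → x - - x ≡ x * + 2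
      x--x≡x*2 = solve-∀
    2∣in+out : + 2 ∣ sumℤ (λ e → + endsAt e v * φ₂ e)
    2∣in+out = subst (+ 2 ∣_) (inflow+outflow φ₂ v) (conserved⇒2∣inflow+outflow conserved)
    total : sumℤ (λ e → + endsAt e v * φ₂ e) + sumℤ (λ e → + endsAt e v * (+ ∣ φ₂ e ∣ - φ₂ e))
          ≡ + sumℕ (λ e → endsAt e v ℕ.* ∣ φ₂ e ∣)
    total = begin
      sumℤ (λ e → + endsAt e v * φ₂ e) + sumℤ (λ e → + endsAt e v * (+ ∣ φ₂ e ∣ - φ₂ e))
        ≡⟨ sumℤ-distrib-+ (λ e → + endsAt e v * φ₂ e) _ ⟨
      sumℤ (λ e → + endsAt e v * φ₂ e + + endsAt e v * (+ ∣ φ₂ e ∣ - φ₂ e))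
        ≡⟨ sumℤ-cong (λ e → trans (cancel (+ endsAt e v) (φ₂ e) (+ ∣ φ₂ e ∣))
                                  (sym (pos-* (endsAt e v) ∣ φ₂ e ∣))) ⟩
      sumℤ (λ e → + (endsAt e v ℕ.* ∣ φ₂ e ∣))
        ≡⟨ sumℤ-pos (λ e → endsAt e v ℕ.* ∣ φ₂ e ∣) ⟩
      + sumℕ (λ e → endsAt e v ℕ.* ∣ φ₂ e ∣) ∎
      where
      open ≡-Reasoning
      cancel : ∀ a x y → a * x + a * (y - x) ≡ a * y
      cancel = solve-∀

  signedAt : (E → ℤ) → E → V → ℤ
  signedAt f e v = (if ⌊ head G o e ≟ v ⌋ then f e else 0ℤ) - (if ⌊ tail G o e ≟ v ⌋ then f e else 0ℤ)

  signedAt-loopless : Loopless G → ∀ f e v →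
    (endsAt e v ≡ 0 × signedAt f e v ≡ 0ℤ) ⊎ (endsAt e v ≡ 1 × ∣ signedAt f e v ∣ ≡ ∣ f e ∣)
  signedAt-loopless loopless f e v rewrite endsAt-oriented e v with head G o e ≟ v | tail G o e ≟ v
  ... | yes h≡v | yes t≡v = ⊥-elim (head≢tail loopless e (trans h≡v (sym t≡v)))
  ... | yes _   | no  _   = inj₂ (refl , cong ∣_∣ (+-identityʳ (f e)))
  ... | no  _   | yes _   = inj₂ (refl , trans (cong ∣_∣ (+-identityˡ (- f e))) (∣-i∣≡∣i∣ (f e)))
  ... | no  _   | no  _   = inj₁ (refl , refl)

  no-moderate-cubic-vertex : ∀ {p q φ v} → Loopless G → p ℕ.< q → IsFlow G (p ℕ.+ q ℕ.+ 1) o φ →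
    (∀ e → endsAt e v ≢ 0 → q ℕ.≤ ∣ φ e ∣) → degree G v ≢ 3
  no-moderate-cubic-vertex {p} {q} {φ} {v} loopless p<q (bounded , conserved) large =
    no-moderate-zero-sum-triple p<q (λ e → signedAt φ e v) moderate sum≡0 ∘ trans (sumℕ-cong support≡ends)
    where
    large-at : ∀ e → endsAt e v ≡ 1 → ∣ signedAt φ e v ∣ ≡ ∣ φ e ∣ → q ℕ.≤ ∣ signedAt φ e v ∣
    large-at e ends≡1 ∣s∣≡∣φ∣ =
      subst (q ℕ.≤_) (sym ∣s∣≡∣φ∣) (large e (λ ends≡0 → ℕ.1+n≢0 (trans (sym ends≡1) ends≡0)))
    moderate : ∀ e → Moderate q (p ℕ.+ q) (signedAt φ e v)
    moderate e with signedAt-loopless loopless φ e v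
    ... | inj₁ (_ , s≡0) = inj₁ s≡0
    ... | inj₂ (ends≡1 , ∣s∣≡∣φ∣) =
      inj₂ (large-at e ends≡1 ∣s∣≡∣φ∣ , subst (ℕ._≤ p ℕ.+ q) (sym ∣s∣≡∣φ∣) (<+1⇒≤ (bounded e)))
    support≡ends : ∀ e → isPositive (signedAt φ e v) ℕ.+ isNegative (signedAt φ e v) ≡ endsAt e v
    support≡ends e with signedAt-loopless loopless φ e v
    ... | inj₁ (ends≡0 , s≡0) = trans (cong (λ s → isPositive s ℕ.+ isNegative s) s≡0) (sym ends≡0)
    ... | inj₂ (ends≡1 , ∣s∣≡∣φ∣) = trans (support-nonzero s≢0) (sym ends≡1)
      where
      s≢0 : signedAt φ e v ≢ 0ℤ
      s≢0 s≡0 = ℕ.<⇒≱ (ℕ.≤-<-trans ℕ.z≤n p<q)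
                      (subst (λ s → q ℕ.≤ ∣ s ∣) s≡0 (large-at e ends≡1 ∣s∣≡∣φ∣))
    sum≡0 : sumℤ (λ e → signedAt φ e v) ≡ 0ℤ
    sum≡0 = trans (sumℤ-distrib-- {m G} _ _) (conserved⇒excess≡0 conserved v)

  zeros-form-perfect-matching : ∀ {p q φ₂ φ} → Loopless G → Cubic G → p ℕ.< q →
    IsFlow G 2 o φ₂ → IsFlow G (p ℕ.+ q ℕ.+ 1) o φ → (∀ e → φ₂ e ≡ 0ℤ → q ℕ.≤ ∣ φ e ∣) →
    PerfectMatching G (λ e → ⌊ φ₂ e ≟ℤ 0ℤ ⌋)
  zeros-form-perfect-matching {p} {q} {φ₂} {φ} loopless cubic p<q (bounded₂ , conserved₂) flow large v =
    odd-part (trans (zeros+nonzeros≡degree φ₂ bounded₂ v) (cubic v))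
             (∣⇒∣ᵤ (2∣nonzeros (conserved₂ v)))
             nonzeros≢0
    where
    nonzeros : ℕ
    nonzeros = sumℕ (λ e → endsAt e v ℕ.* ∣ φ₂ e ∣)
    odd-part : ∀ {z w} → z ℕ.+ w ≡ 3 → 2 ℕ.∣ w → w ≢ 0 → z ≡ 1
    odd-part {0}             refl (ℕ.divides (suc (suc _)) ()) _
    odd-part {1}             refl _                            _   = refl
    odd-part {2}             refl (ℕ.divides 0 ())             _
    odd-part {3}             refl _                            w≢0 = ⊥-elim (w≢0 refl)
    odd-part {suc (suc (suc (suc _)))} ()
    nonzeros≢0 : nonzeros ≢ 0
    nonzeros≢0 none = no-moderate-cubic-vertex loopless p<q flow large-at-v (cubic v)
      where
      large-at-v : ∀ e → endsAt e v ≢ 0 → q ℕ.≤ ∣ φ e ∣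
      large-at-v e ends≢0 with ℕ.m*n≡0⇒m≡0∨n≡0 (endsAt e v) (sumℕ≡0⇒≡0 _ none e)
      ... | inj₁ ends≡0  = ⊥-elim (ends≢0 ends≡0)
      ... | inj₂ ∣φ₂∣≡0 = large e (∣i∣≡0⇒i≡0 ∣φ₂∣≡0)

module Rescaling (G : Graph) (o : Orientation G) where
  open import Data.Nat as ℕ using (suc)
  import Data.Nat.Properties as ℕ
  open import Data.Integer using (ℤ; +_; 0ℤ; _+_; _-_; _*_; ∣_∣)
  open import Data.Integer.Properties
    using (*-zeroʳ; *-zeroˡ; *-comm; *-cancelʳ-≡; abs-*; ∣i-j∣≤∣i∣+∣j∣; ∣i+j∣≤∣i∣+∣j∣)
  open import Data.Integer.Divisibility.Signed using (_∣_; quotient)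
  open import Data.Integer.Tactic.RingSolver using (solve-∀)
  open Flows G o
  open Arithmetic using (<+1⇒≤; quotient-upper; quotient-lower)
  open SumℤProperties using (∣0)

  private
    E : Set
    E = Fin (m G)

  rescale : ∀ {p q p′ q′ φ} → 0 ℕ.< q′ → p′ ℕ.* q ≡ p ℕ.* q′ → IsFlow G (p′ ℕ.+ q′ ℕ.+ 1) o φ →
            ∃ λ ψ → IsFlow G (p ℕ.+ q ℕ.+ 1) o ψ × (∀ e → q′ ℕ.≤ ∣ φ e ∣ → q ℕ.≤ ∣ ψ e ∣)
  rescale {p} {q} {p′} {suc c} {φ} _ p′q≡pk (φ-bounded , φ-conserved) =
    ψ , (ψ-bounded , excess≡0⇒conserved ψ-balanced) , ψ-large
    where
    k : ℕ
    k = suc c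
    h : E → ℤ
    h e = + q * φ e
    h-balanced : ∀ v → excess h v ≡ 0ℤ
    h-balanced v = trans (excess-*ˡ (+ q) φ v)
                         (trans (cong (+ q *_) (conserved⇒excess≡0 φ-conserved v)) (*-zeroʳ (+ q)))
    lifted : ∃ λ r → IsFlow G k o r × (∀ e → + k ∣ h e - r e)
    lifted = ModularFlow.lift-modular-flow G o k h (λ v → subst (+ k ∣_) (sym (h-balanced v)) (∣0 (+ k)))
    r : E → ℤ
    r = proj₁ lifted
    r-bounded : ∀ e → ∣ r e ∣ ℕ.< k
    r-bounded = proj₁ (proj₁ (proj₂ lifted))
    r-conserved : ∀ v → inflow r v ≡ outflow r v
    r-conserved = proj₂ (proj₁ (proj₂ lifted))
    ψ : E → ℤ
    ψ e = quotient (proj₂ (proj₂ lifted) e)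
    h-r≡ψk : ∀ e → h e - r e ≡ ψ e * + k
    h-r≡ψk e = _∣_.equality (proj₂ (proj₂ lifted) e)
    ψ-balanced : ∀ v → excess ψ v ≡ 0ℤ
    ψ-balanced v = *-cancelʳ-≡ (excess ψ v) 0ℤ (+ k) (begin
      excess ψ v * + k                    ≡⟨ *-comm (excess ψ v) (+ k) ⟩
      + k * excess ψ v                    ≡⟨ excess-*ˡ (+ k) ψ v ⟨
      excess (λ e → + k * ψ e) v          ≡⟨ excess-cong (λ e → trans (*-comm (+ k) (ψ e)) (sym (h-r≡ψk e))) v ⟩
      excess (λ e → h e - r e) v          ≡⟨ excess-- h r v ⟩
      excess h v - excess r v             ≡⟨ cong₂ _-_ (h-balanced v) (conserved⇒excess≡0 r-conserved v) ⟩
      0ℤ                                  ≡⟨ *-zeroˡ (+ k) ⟨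
      0ℤ * + k                            ∎)
      where open ≡-Reasoning
    ∣h∣ : ∀ e → ∣ h e ∣ ≡ q ℕ.* ∣ φ e ∣
    ∣h∣ e = abs-* (+ q) (φ e)
    ∣ψk∣ : ∀ e → ∣ ψ e * + k ∣ ≡ k ℕ.* ∣ ψ e ∣
    ∣ψk∣ e = trans (abs-* (ψ e) (+ k)) (ℕ.*-comm ∣ ψ e ∣ k)
    ψ-bounded : ∀ e → ∣ ψ e ∣ ℕ.< p ℕ.+ q ℕ.+ 1
    ψ-bounded e = quotient-upper p′q≡pk (<+1⇒≤ (φ-bounded e)) (ℕ.≤-pred (r-bounded e)) (begin
      k ℕ.* ∣ ψ e ∣              ≡⟨ ∣ψk∣ e ⟨
      ∣ ψ e * + k ∣              ≡⟨ cong ∣_∣ (h-r≡ψk e) ⟨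
      ∣ h e - r e ∣              ≤⟨ ∣i-j∣≤∣i∣+∣j∣ (h e) (r e) ⟩
      ∣ h e ∣ ℕ.+ ∣ r e ∣        ≡⟨ cong (ℕ._+ ∣ r e ∣) (∣h∣ e) ⟩
      q ℕ.* ∣ φ e ∣ ℕ.+ ∣ r e ∣  ∎)
      where open ℕ.≤-Reasoning
    ψ-large : ∀ e → k ℕ.≤ ∣ φ e ∣ → q ℕ.≤ ∣ ψ e ∣
    ψ-large e k≤∣φ∣ = quotient-lower k≤∣φ∣ (begin
      q ℕ.* ∣ φ e ∣              ≡⟨ ∣h∣ e ⟨
      ∣ h e ∣                    ≡⟨ cong ∣_∣ (a-b≡c⇒a≡b+c {h e} {r e} (h-r≡ψk e)) ⟩
      ∣ r e + ψ e * + k ∣        ≤⟨ ∣i+j∣≤∣i∣+∣j∣ (r e) (ψ e * + k) ⟩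
      ∣ r e ∣ ℕ.+ ∣ ψ e * + k ∣  ≡⟨ cong (∣ r e ∣ ℕ.+_) (∣ψk∣ e) ⟩
      ∣ r e ∣ ℕ.+ k ℕ.* ∣ ψ e ∣  ∎) (ℕ.≤-pred (r-bounded e))
      where
      open ℕ.≤-Reasoning
      a-b≡c⇒a≡b+c : ∀ {a b c} → a - b ≡ c → a ≡ b + c
      a-b≡c⇒a≡b+c {a} {b} refl = b+[a-b]≡a a b
        where
        b+[a-b]≡a : ∀ a b → a ≡ b + (a - b)
        b+[a-b]≡a = solve-∀

open import Data.Nat using (_+_; _<_; _≤_; s≤s)
open import Data.Integer using (ℤ; +_; 0ℤ; 1ℤ; _-_; ∣_∣)
open import Data.Integer.Properties using () renaming (_≟_ to _≟ℤ_)
import Data.Nat.Divisibility as ℕ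
open import Data.Integer.Divisibility.Signed using (_∣_; ∣⇒∣ᵤ)
open import Function.Bundles using (_⇔_; mk⇔)

MatchingFlow : Graph → ℕ → ℕ → Set
MatchingFlow G p q =
  Σ (Fin (m G) → Bool) λ M → PerfectMatching G M ×
    Σ (Orientation G) λ o → Σ (Fin (m G) → ℤ) λ φ →
      IsFlow G (p + q + 1) o φ × (∀ e → M e ≡ true → q ≤ ∣ φ e ∣)

flowPair⇒matchingFlow : ∀ {p q G} → p < q → Loopless G → Cubic G →
                        HasFlowPair G p q → MatchingFlow G p q
flowPair⇒matchingFlow {G = G} p<q loopless cubic
  (p′ , q′ , _ , 0<q′ , p′q≡pq′ , o , φ₂ , φ , two-flow , flow , large) =
  let ψ , ψ-flow , ψ-large = Rescaling.rescale G o 0<q′ p′q≡pq′ flow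
      p′<q′ = Arithmetic.ratio-< 0<q′ p′q≡pq′ p<q
  in (λ e → ⌊ φ₂ e ≟ℤ 0ℤ ⌋) ,
     Incidence.zeros-form-perfect-matching G o loopless cubic p′<q′ two-flow flow large ,
     o , ψ , ψ-flow , λ e φ₂e≟0 → ψ-large e (large e (≟-true φ₂e≟0))
  where
  ≟-true : ∀ {e} → ⌊ φ₂ e ≟ℤ 0ℤ ⌋ ≡ true → φ₂ e ≡ 0ℤ
  ≟-true {e} _ with φ₂ e ≟ℤ 0ℤ
  ... | yes φ₂e≡0 = φ₂e≡0

matchingFlow⇒flowPair : ∀ {p q G} → 0 < p → 0 < q → Cubic G →
                        MatchingFlow G p q → HasFlowPair G p q
matchingFlow⇒flowPair {p} {q} {G} 0<p 0<q cubic (M , perfect , o , φ , flow , large) =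
  let φ₂ , two-flow , congruent = ModularFlow.lift-modular-flow G o 2 indicator
                                    (Incidence.complement-of-perfect-matching-is-even G o cubic perfect)
  in p , q , 0<p , 0<q , refl , o , φ₂ , φ , two-flow , flow ,
     λ e φ₂e≡0 → large e (matched e (subst (λ x → + 2 ∣ indicator e - x) φ₂e≡0 (congruent e)))
  where
  indicator : Fin (m G) → ℤ
  indicator e = if M e then 0ℤ else 1ℤ
  matched : ∀ e → + 2 ∣ indicator e - 0ℤ → M e ≡ true
  matched e 2∣ with M e
  ... | true  = refl
  ... | false with ℕ.∣⇒≤ (∣⇒∣ᵤ 2∣)
  ...   | s≤s ()

corollary24 : (p q : ℕ) → 0 < p → 0 < q → p < q →
    (G : Graph) → Snark G →
    HasFlowPair G p q ⇔
      (Σ (Fin (m G) → Bool) λ M → PerfectMatching G M ×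
        Σ (Orientation G) λ o → Σ (Fin (m G) → ℤ) λ φ →
          IsFlow G (p + q + 1) o φ × (∀ e → M e ≡ true → q ≤ ∣ φ e ∣))
corollary24 p q 0<p 0<q p<q G (_ , (loopless , _) , cubic , _) =
  mk⇔ (flowPair⇒matchingFlow p<q loopless cubic) (matchingFlow⇒flowPair 0<p 0<q cubic)
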